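{- Let $n$ be a positive even integer and let $P_n(x_1,\dots,x_n)=(x_1-x_2)(x_2-x_3)\cdots(x_{n-1}-x_n)(x_n-x_1)$. Then $\mathcal L(P_n)(x)=2x^{n/2}$.
   Context: For a homogeneous polynomial $P(x_1,\dots,x_n)=\sum_{j_1+\cdots+j_n=m}c_{j_1,\dots,j_n}x_1^{j_1}\cdots x_n^{j_n}\in\mathbb C[x_1,\dots,x_n]$ of degree $m$, define the one-variable polynomial $\mathcal L(P)(x)=\sum_{j_1+\cdots+j_n=m}c_{j_1,\dots,j_n}(x)_{j_1}\cdots(x)_{j_n}$, where $(x)_j=x(x-1)\cdots(x-j+1)$ denotes the falling factorial (with $(x)_0=1$). -}

module Defs where

open import Data.Nat as ℕ using (ℕ; zero; suc)
open import Data.Nat.DivMod using (_%_; m%n<n)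
open import Data.Integer as ℤ using (ℤ; +_; -_)
open import Data.Fin using (Fin; zero; suc; toℕ; fromℕ<; _≟_)
open import Data.Vec using (Vec; tabulate; zipWith; replicate; toList)
open import Data.List using (List; []; _∷_; _++_; map; foldr; concatMap; allFin)
open import Data.Product using (_×_; _,_)
open import Relation.Nullary using (yes; no)
open import Relation.Binary.PropositionalEquality using (_≡_; refl)

-- Univariate polynomials over ℤ: coefficient lists, lowest degree first.
UPoly : Set
UPoly = List ℤ

infixl 6 _⊕_
_⊕_ : UPoly → UPoly → UPoly
[]       ⊕ q        = q
(a ∷ p)  ⊕ []       = a ∷ p
(a ∷ p)  ⊕ (b ∷ q)  = (a ℤ.+ b) ∷ (p ⊕ q)

scale : ℤ → UPoly → UPoly
scale c = map (c ℤ.*_)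

infixl 7 _⊛_
_⊛_ : UPoly → UPoly → UPoly
[]      ⊛ q = []
(a ∷ p) ⊛ q = scale a q ⊕ (ℤ.0ℤ ∷ (p ⊛ q))

normalize : UPoly → UPoly
normalize []      = []
normalize (a ∷ p) with normalize p
... | [] with a ℤ.≟ ℤ.0ℤ
...   | yes _ = []
...   | no  _ = a ∷ []
normalize (a ∷ p) | b ∷ q = a ∷ b ∷ q

_≈ₚ_ : UPoly → UPoly → Set
p ≈ₚ q = normalize p ≡ normalize q

xPow : ℕ → UPoly
xPow zero    = ℤ.1ℤ ∷ []
xPow (suc k) = ℤ.0ℤ ∷ xPow k

falling : ℕ → UPoly
falling zero    = ℤ.1ℤ ∷ []
falling (suc j) = falling j ⊛ ((- (+ j)) ∷ ℤ.1ℤ ∷ [])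

-- Multivariate polynomials in x_0,…,x_{n-1} over ℤ, as formal sums of
-- terms (coefficient, exponent vector).
Monomial : ℕ → Set
Monomial n = Vec ℕ n

MPoly : ℕ → Set
MPoly n = List (ℤ × Monomial n)

mone : ∀ {n} → MPoly n
mone = (ℤ.1ℤ , replicate _ 0) ∷ []

var : ∀ {n} → Fin n → MPoly n
var i = (ℤ.1ℤ , tabulate (λ j → δ i j)) ∷ []
  where
  δ : ∀ {n} → Fin n → Fin n → ℕ
  δ a b with a ≟ b
  ... | yes _ = 1
  ... | no  _ = 0

madd : ∀ {n} → MPoly n → MPoly n → MPoly n
madd = _++_

mneg : ∀ {n} → MPoly n → MPoly n
mneg = map (λ { (c , e) → (- c , e) })

msub : ∀ {n} → MPoly n → MPoly n → MPoly n
msub p q = madd p (mneg q)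

mmul : ∀ {n} → MPoly n → MPoly n → MPoly n
mmul p q = concatMap (λ { (c , e) → map (λ { (d , f) → (c ℤ.* d , zipWith ℕ._+_ e f) }) q }) p

next : ∀ {n} → Fin n → Fin n
next {suc m} i = fromℕ< (m%n<n (suc (toℕ i)) (suc m))

-- P_n = (x_1-x_2)(x_2-x_3)⋯(x_{n-1}-x_n)(x_n-x_1)  (0-indexed here)
Pcyc : (n : ℕ) → MPoly n
Pcyc n = foldr mmul mone (map (λ i → msub (var i) (var (next i))) (allFin n))

𝓛mon : ∀ {n} → Monomial n → UPoly
𝓛mon e = foldr (λ j acc → falling j ⊛ acc) (ℤ.1ℤ ∷ []) (toList e)

𝓛 : ∀ {n} → MPoly n → UPoly
𝓛 p = foldr (λ { (c , e) acc → scale c (𝓛mon e) ⊕ acc }) [] p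

{-# OPTIONS --safe #-}
-- Expanding P_n = ∏ᵢ (xᵢ − xᵢ₊₁) means choosing from each factor either xᵢ (bᵢ = true) or
-- −xᵢ₊₁ (bᵢ = false). The variable xᵢ then has exponent [bᵢ] + [¬ bᵢ₋₁] (indices mod n), so 𝓛
-- maps the resulting term to the cyclic product ∏ᵢ T(bᵢ₋₁, bᵢ) with T(a, b) = ±(x)_{[b] + [¬ a]}.
-- Summing over all choices, 𝓛(P_n) = tr Tⁿ for the 2 × 2 matrix T = [[x, −1], [x² − x, −x]],
-- and T² = x·I gives tr T^{2k} = 2xᵏ.
module Submission where

open import Defs
open import Data.Nat using (ℕ; _*_; _≤_)
open import Data.Integer using (+_)

open import Algebra.Bundles using (CommutativeMonoid)
import Algebra.Properties.CommutativeSemigroup as CommutativeSemigroupProperties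
open import Data.Bool using (Bool; true; false; not)
open import Data.Empty using (⊥-elim)
open import Data.Fin as Fin using (Fin; zero; suc; toℕ; fromℕ; inject₁)
import Data.Fin.Properties as Fin
open import Data.Integer as ℤ using (ℤ; -_)
import Data.Integer.Properties as ℤ
open import Data.Integer.Tactic.RingSolver using (solve-∀)
open import Data.List as List using (List; []; _∷_; _++_; map; foldr)
open import Data.List.Properties using (map-∘; map-++; ++-identityʳ)
open import Data.Nat as ℕ using (zero; suc; s≤s)
import Data.Nat.Properties as ℕ
open import Data.Nat.DivMod using (_%_; n%n≡0; m<n⇒m%n≡m)
open import Algebra.Properties.CommutativeMonoid.Sum ℕ.+-0-commutativeMonoid
  using (sum; ∑-distrib-+; sum-cong-≗; sum-replicate-zero)
open import Data.Product using (_×_; _,_; proj₁; Σ)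
open import Data.Sum using (_⊎_; inj₁; inj₂)
open import Data.Vec as Vec using (Vec; []; _∷_)
open import Data.Vec.Properties
  using (lookup∘tabulate; tabulate∘lookup; tabulate-cong; lookup-zipWith; lookup-replicate)
open import Function using (id; _∘_)
open import Relation.Binary.Bundles using (Setoid)
open import Relation.Binary.PropositionalEquality
import Relation.Binary.Reasoning.Setoid as SetoidReasoning
open import Relation.Binary.Structures using (IsEquivalence)
open import Relation.Nullary using (Dec; yes; no; ¬_)

-- Polynomials up to equality of coefficients

coeff : UPoly → ℕ → ℤ
coeff []      _       = ℤ.0ℤ
coeff (a ∷ p) zero    = a
coeff (a ∷ p) (suc i) = coeff p i

infix 4 _≋_
record _≋_ (p q : UPoly) : Set where
  constructor coeffwise
  field coeff-≡ : ∀ i → coeff p i ≡ coeff q i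
open _≋_ public

≋-isEquivalence : IsEquivalence _≋_
≋-isEquivalence = record
  { refl  = coeffwise λ _ → refl
  ; sym   = λ p≋q → coeffwise λ i → sym (coeff-≡ p≋q i)
  ; trans = λ p≋q q≋r → coeffwise λ i → trans (coeff-≡ p≋q i) (coeff-≡ q≋r i)
  }

open IsEquivalence ≋-isEquivalence public
  using () renaming (refl to ≋-refl; sym to ≋-sym; trans to ≋-trans; reflexive to ≡⇒≋)

≋-setoid : Setoid _ _
≋-setoid = record { isEquivalence = ≋-isEquivalence }

module ≋-Reasoning = SetoidReasoning ≋-setoid

consNormal : ℤ → UPoly → UPoly
consNormal a [] with a ℤ.≟ ℤ.0ℤ
... | yes _ = []
... | no _  = a ∷ []
consNormal a (b ∷ q) = a ∷ b ∷ q

normalize-∷ : ∀ a p → normalize (a ∷ p) ≡ consNormal a (normalize p)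
normalize-∷ a p with normalize p
... | [] with a ℤ.≟ ℤ.0ℤ
...   | yes _ = refl
...   | no _  = refl
normalize-∷ a p | b ∷ q = refl

≋⇒≈ₚ : ∀ {p q} → p ≋ q → p ≈ₚ q
≋⇒≈ₚ {[]}    {[]}    p≋q = refl
≋⇒≈ₚ {[]}    {b ∷ q} p≋q = sym (trans (normalize-∷ b q)
  (cong₂ consNormal (sym (coeff-≡ p≋q zero)) (sym (≋⇒≈ₚ {[]} {q} (coeffwise (λ i → coeff-≡ p≋q (suc i)))))))
≋⇒≈ₚ {a ∷ p} {[]}    p≋q = trans (normalize-∷ a p)
  (cong₂ consNormal (coeff-≡ p≋q zero) (≋⇒≈ₚ {p} {[]} (coeffwise (λ i → coeff-≡ p≋q (suc i)))))
≋⇒≈ₚ {a ∷ p} {b ∷ q} p≋q = begin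
  normalize (a ∷ p)             ≡⟨ normalize-∷ a p ⟩
  consNormal a (normalize p)    ≡⟨ cong₂ consNormal (coeff-≡ p≋q zero) (≋⇒≈ₚ {p} {q} (coeffwise (λ i → coeff-≡ p≋q (suc i)))) ⟩
  consNormal b (normalize q)    ≡⟨ normalize-∷ b q ⟨
  normalize (b ∷ q)             ∎
  where open ≡-Reasoning

coeff-⊕ : ∀ p q i → coeff (p ⊕ q) i ≡ coeff p i ℤ.+ coeff q i
coeff-⊕ []      q       i       = sym (ℤ.+-identityˡ _)
coeff-⊕ (a ∷ p) []      i       = sym (ℤ.+-identityʳ _)
coeff-⊕ (a ∷ p) (b ∷ q) zero    = refl
coeff-⊕ (a ∷ p) (b ∷ q) (suc i) = coeff-⊕ p q i

coeff-scale : ∀ c p i → coeff (scale c p) i ≡ c ℤ.* coeff p i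
coeff-scale c []      i       = sym (ℤ.*-zeroʳ c)
coeff-scale c (a ∷ p) zero    = refl
coeff-scale c (a ∷ p) (suc i) = coeff-scale c p i

⊕-cong : ∀ {p p′ q q′} → p ≋ p′ → q ≋ q′ → p ⊕ q ≋ p′ ⊕ q′
⊕-cong {p} {p′} {q} {q′} p≋p′ q≋q′ = coeffwise λ i → begin
  coeff (p ⊕ q) i             ≡⟨ coeff-⊕ p q i ⟩
  coeff p i ℤ.+ coeff q i     ≡⟨ cong₂ ℤ._+_ (coeff-≡ p≋p′ i) (coeff-≡ q≋q′ i) ⟩
  coeff p′ i ℤ.+ coeff q′ i   ≡⟨ coeff-⊕ p′ q′ i ⟨
  coeff (p′ ⊕ q′) i           ∎
  where open ≡-Reasoning

⊕-assoc : ∀ p q r → (p ⊕ q) ⊕ r ≋ p ⊕ (q ⊕ r)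
⊕-assoc p q r = coeffwise λ i → begin
  coeff ((p ⊕ q) ⊕ r) i                      ≡⟨ trans (coeff-⊕ (p ⊕ q) r i) (cong (ℤ._+ _) (coeff-⊕ p q i)) ⟩
  coeff p i ℤ.+ coeff q i ℤ.+ coeff r i      ≡⟨ ℤ.+-assoc (coeff p i) _ _ ⟩
  coeff p i ℤ.+ (coeff q i ℤ.+ coeff r i)    ≡⟨ trans (coeff-⊕ p (q ⊕ r) i) (cong₂ ℤ._+_ (refl {x = coeff p i}) (coeff-⊕ q r i)) ⟨
  coeff (p ⊕ (q ⊕ r)) i                      ∎
  where open ≡-Reasoning

⊕-comm : ∀ p q → p ⊕ q ≋ q ⊕ p
⊕-comm p q = coeffwise λ i →
  trans (coeff-⊕ p q i) (trans (ℤ.+-comm (coeff p i) _) (sym (coeff-⊕ q p i)))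

⊕-identityʳ : ∀ p → p ⊕ [] ≋ p
⊕-identityʳ []      = ≋-refl
⊕-identityʳ (a ∷ p) = ≋-refl

⊕-commutativeMonoid : CommutativeMonoid _ _
⊕-commutativeMonoid = record
  { Carrier             = UPoly
  ; _≈_                 = _≋_
  ; _∙_                 = _⊕_
  ; ε                   = []
  ; isCommutativeMonoid = record
    { isMonoid = record
      { isSemigroup = record
        { isMagma = record { isEquivalence = ≋-isEquivalence ; ∙-cong = ⊕-cong }
        ; assoc   = ⊕-assoc
        }
      ; identity = (λ _ → ≋-refl) , ⊕-identityʳ
      }
    ; comm = ⊕-comm
    }
  }

open CommutativeSemigroupProperties (CommutativeMonoid.commutativeSemigroup ⊕-commutativeMonoid)
  using (interchange)

∑ : ∀ {A : Set} → (A → UPoly) → List A → UPoly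
∑ f []       = []
∑ f (x ∷ xs) = f x ⊕ ∑ f xs

∑-cong : ∀ {A : Set} {f g : A → UPoly} xs → (∀ x → f x ≋ g x) → ∑ f xs ≋ ∑ g xs
∑-cong []       f≋g = ≋-refl
∑-cong (x ∷ xs) f≋g = ⊕-cong (f≋g x) (∑-cong xs f≋g)

∑-map : ∀ {A B : Set} (f : B → UPoly) (g : A → B) xs → ∑ f (map g xs) ≡ ∑ (λ x → f (g x)) xs
∑-map f g []       = refl
∑-map f g (x ∷ xs) = cong (f (g x) ⊕_) (∑-map f g xs)

∑-++ : ∀ {A : Set} (f : A → UPoly) xs ys → ∑ f (xs ++ ys) ≋ ∑ f xs ⊕ ∑ f ys
∑-++ f []       ys = ≋-refl
∑-++ f (x ∷ xs) ys = ≋-trans (⊕-cong ≋-refl (∑-++ f xs ys)) (≋-sym (⊕-assoc (f x) (∑ f xs) (∑ f ys)))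

∑-⊕ : ∀ {A : Set} (f g : A → UPoly) xs → ∑ (λ x → f x ⊕ g x) xs ≋ ∑ f xs ⊕ ∑ g xs
∑-⊕ f g []       = ≋-refl
∑-⊕ f g (x ∷ xs) =
  ≋-trans (⊕-cong ≋-refl (∑-⊕ f g xs)) (interchange (f x) (g x) (∑ f xs) (∑ g xs))

infixr 8 x·_ -ₚ_

x·_ : UPoly → UPoly
x· p = ℤ.0ℤ ∷ p

x·-cong : ∀ {p q} → p ≋ q → x· p ≋ x· q
x·-cong p≋q = coeffwise λ { zero → refl ; (suc i) → coeff-≡ p≋q i }

x·[]≋[] : x· [] ≋ []
x·[]≋[] = coeffwise λ { zero → refl ; (suc i) → refl }

scale-cong : ∀ c {p q} → p ≋ q → scale c p ≋ scale c q
scale-cong c {p} {q} p≋q = coeffwise λ i →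
  trans (coeff-scale c p i) (trans (cong (c ℤ.*_) (coeff-≡ p≋q i)) (sym (coeff-scale c q i)))

scale-distrib-⊕ : ∀ c p q → scale c (p ⊕ q) ≋ scale c p ⊕ scale c q
scale-distrib-⊕ c p q = coeffwise λ i → begin
  coeff (scale c (p ⊕ q)) i                      ≡⟨ trans (coeff-scale c (p ⊕ q) i) (cong (c ℤ.*_) (coeff-⊕ p q i)) ⟩
  c ℤ.* (coeff p i ℤ.+ coeff q i)                ≡⟨ ℤ.*-distribˡ-+ c (coeff p i) _ ⟩
  c ℤ.* coeff p i ℤ.+ c ℤ.* coeff q i            ≡⟨ trans (coeff-⊕ (scale c p) (scale c q) i)
                                                          (cong₂ ℤ._+_ (coeff-scale c p i) (coeff-scale c q i)) ⟨
  coeff (scale c p ⊕ scale c q) i                ∎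
  where open ≡-Reasoning

scale-scale : ∀ c d p → scale c (scale d p) ≋ scale (c ℤ.* d) p
scale-scale c d p = coeffwise λ i → begin
  coeff (scale c (scale d p)) i   ≡⟨ trans (coeff-scale c (scale d p) i) (cong (c ℤ.*_) (coeff-scale d p i)) ⟩
  c ℤ.* (d ℤ.* coeff p i)         ≡⟨ ℤ.*-assoc c d _ ⟨
  c ℤ.* d ℤ.* coeff p i           ≡⟨ coeff-scale (c ℤ.* d) p i ⟨
  coeff (scale (c ℤ.* d) p) i     ∎
  where open ≡-Reasoning

scale-comm : ∀ c d p → scale c (scale d p) ≋ scale d (scale c p)
scale-comm c d p = ≋-trans (scale-scale c d p)
  (≋-trans (≡⇒≋ (cong (λ e → scale e p) (ℤ.*-comm c d))) (≋-sym (scale-scale d c p)))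

scale-x· : ∀ c p → scale c (x· p) ≋ x· scale c p
scale-x· c p = coeffwise λ { zero → ℤ.*-zeroʳ c ; (suc i) → refl }

scale-0 : ∀ p → scale ℤ.0ℤ p ≋ []
scale-0 p = coeffwise λ i → trans (coeff-scale ℤ.0ℤ p i) (ℤ.*-zeroˡ (coeff p i))

scale-1 : ∀ p → scale ℤ.1ℤ p ≋ p
scale-1 p = coeffwise λ i → trans (coeff-scale ℤ.1ℤ p i) (ℤ.*-identityˡ (coeff p i))

⊕-double : ∀ p → p ⊕ p ≋ scale (+ 2) p
⊕-double p = coeffwise λ i →
  trans (coeff-⊕ p p i) (trans (a+a≡2a (coeff p i)) (sym (coeff-scale (+ 2) p i)))
  where
  a+a≡2a : ∀ a → a ℤ.+ a ≡ + 2 ℤ.* a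
  a+a≡2a = solve-∀

const-⊛ : ∀ c q → (c ∷ []) ⊛ q ≋ scale c q
const-⊛ c q = ≋-trans (⊕-cong ≋-refl x·[]≋[]) (⊕-identityʳ (scale c q))

x·-⊛ : ∀ p q → x· p ⊛ q ≋ x· (p ⊛ q)
x·-⊛ p q = ⊕-cong (scale-0 q) ≋-refl

⊛-congʳ : ∀ p {q q′} → q ≋ q′ → p ⊛ q ≋ p ⊛ q′
⊛-congʳ []      q≋q′ = ≋-refl
⊛-congʳ (a ∷ p) q≋q′ = ⊕-cong (scale-cong a q≋q′) (x·-cong (⊛-congʳ p q≋q′))

⊛-zeroʳ : ∀ p → p ⊛ [] ≋ []
⊛-zeroʳ []      = ≋-refl
⊛-zeroʳ (a ∷ p) = ≋-trans (x·-cong (⊛-zeroʳ p)) x·[]≋[]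

⊛-distribˡ-⊕ : ∀ p q r → p ⊛ (q ⊕ r) ≋ p ⊛ q ⊕ p ⊛ r
⊛-distribˡ-⊕ []      q r = ≋-refl
⊛-distribˡ-⊕ (a ∷ p) q r = begin
  scale a (q ⊕ r) ⊕ x· (p ⊛ (q ⊕ r))                   ≈⟨ ⊕-cong (scale-distrib-⊕ a q r) (x·-cong (⊛-distribˡ-⊕ p q r)) ⟩
  (scale a q ⊕ scale a r) ⊕ (x· (p ⊛ q) ⊕ x· (p ⊛ r))  ≈⟨ interchange (scale a q) (scale a r) (x· (p ⊛ q)) (x· (p ⊛ r)) ⟩
  (scale a q ⊕ x· (p ⊛ q)) ⊕ (scale a r ⊕ x· (p ⊛ r))  ∎
  where open ≋-Reasoning

⊛-∑ : ∀ {A : Set} p (f : A → UPoly) xs → p ⊛ ∑ f xs ≋ ∑ (λ x → p ⊛ f x) xs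
⊛-∑ p f []       = ⊛-zeroʳ p
⊛-∑ p f (x ∷ xs) = ≋-trans (⊛-distribˡ-⊕ p (f x) (∑ f xs)) (⊕-cong ≋-refl (⊛-∑ p f xs))

scale-⊛ : ∀ c p q → scale c p ⊛ q ≋ scale c (p ⊛ q)
scale-⊛ c []      q = ≋-refl
scale-⊛ c (a ∷ p) q = begin
  scale (c ℤ.* a) q ⊕ x· (scale c p ⊛ q)           ≈⟨ ⊕-cong (≋-sym (scale-scale c a q)) (x·-cong (scale-⊛ c p q)) ⟩
  scale c (scale a q) ⊕ x· scale c (p ⊛ q)         ≈⟨ ⊕-cong ≋-refl (≋-sym (scale-x· c (p ⊛ q))) ⟩
  scale c (scale a q) ⊕ scale c (x· (p ⊛ q))       ≈⟨ scale-distrib-⊕ c (scale a q) (x· (p ⊛ q)) ⟨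
  scale c (scale a q ⊕ x· (p ⊛ q))                 ∎
  where open ≋-Reasoning

⊛-scale : ∀ c p q → p ⊛ scale c q ≋ scale c (p ⊛ q)
⊛-scale c []      q = ≋-refl
⊛-scale c (a ∷ p) q = begin
  scale a (scale c q) ⊕ x· (p ⊛ scale c q)         ≈⟨ ⊕-cong (scale-comm a c q) (x·-cong (⊛-scale c p q)) ⟩
  scale c (scale a q) ⊕ x· scale c (p ⊛ q)         ≈⟨ ⊕-cong ≋-refl (≋-sym (scale-x· c (p ⊛ q))) ⟩
  scale c (scale a q) ⊕ scale c (x· (p ⊛ q))       ≈⟨ scale-distrib-⊕ c (scale a q) (x· (p ⊛ q)) ⟨
  scale c (scale a q ⊕ x· (p ⊛ q))                 ∎
  where open ≋-Reasoning

scale-⊛-scale : ∀ c d p q → scale c p ⊛ scale d q ≋ scale (c ℤ.* d) (p ⊛ q)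
scale-⊛-scale c d p q = begin
  scale c p ⊛ scale d q       ≈⟨ scale-⊛ c p (scale d q) ⟩
  scale c (p ⊛ scale d q)     ≈⟨ scale-cong c (⊛-scale d p q) ⟩
  scale c (scale d (p ⊛ q))   ≈⟨ scale-scale c d (p ⊛ q) ⟩
  scale (c ℤ.* d) (p ⊛ q)     ∎
  where open ≋-Reasoning

-ₚ_ : UPoly → UPoly
-ₚ_ = scale ℤ.-1ℤ

coeff-neg : ∀ p i → coeff (-ₚ p) i ≡ - coeff p i
coeff-neg p i = trans (coeff-scale ℤ.-1ℤ p i) (ℤ.-1*i≡-i (coeff p i))

⊕-inverseʳ : ∀ p → p ⊕ -ₚ p ≋ []
⊕-inverseʳ p = coeffwise λ i →
  trans (coeff-⊕ p (-ₚ p) i) (trans (cong₂ ℤ._+_ (refl {x = coeff p i}) (coeff-neg p i)) (ℤ.+-inverseʳ (coeff p i)))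

p⊕neg[negq⊕p]≋q : ∀ p q → p ⊕ -ₚ (-ₚ q ⊕ p) ≋ q
p⊕neg[negq⊕p]≋q p q = coeffwise λ i → begin
  coeff (p ⊕ -ₚ (-ₚ q ⊕ p)) i
    ≡⟨ trans (coeff-⊕ p _ i) (cong₂ ℤ._+_ (refl {x = coeff p i}) (trans (coeff-neg (-ₚ q ⊕ p) i)
         (cong -_ (trans (coeff-⊕ (-ₚ q) p i) (cong₂ ℤ._+_ (coeff-neg q i) (refl {x = coeff p i})))))) ⟩
  coeff p i ℤ.+ - (- coeff q i ℤ.+ coeff p i)
    ≡⟨ identity (coeff p i) (coeff q i) ⟩
  coeff q i ∎
  where
  open ≡-Reasoning
  identity : ∀ a b → a ℤ.+ - (- b ℤ.+ a) ≡ b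
  identity = solve-∀

neg²q⊕negp⊕neg²p≋q : ∀ p q → (-ₚ -ₚ q ⊕ -ₚ p) ⊕ -ₚ -ₚ p ≋ q
neg²q⊕negp⊕neg²p≋q p q = coeffwise λ i → begin
  coeff ((-ₚ -ₚ q ⊕ -ₚ p) ⊕ -ₚ -ₚ p) i
    ≡⟨ trans (coeff-⊕ (-ₚ -ₚ q ⊕ -ₚ p) _ i)
         (cong₂ ℤ._+_ (trans (coeff-⊕ (-ₚ -ₚ q) (-ₚ p) i) (cong₂ ℤ._+_ (coeff-neg² q i) (coeff-neg p i)))
                      (coeff-neg² p i)) ⟩
  (- - coeff q i ℤ.+ - coeff p i) ℤ.+ - - coeff p i
    ≡⟨ identity (coeff p i) (coeff q i) ⟩
  coeff q i ∎
  where
  open ≡-Reasoning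
  coeff-neg² : ∀ r i → coeff (-ₚ -ₚ r) i ≡ - - coeff r i
  coeff-neg² r i = trans (coeff-neg (-ₚ r) i) (cong -_ (coeff-neg r i))
  identity : ∀ a b → (- - b ℤ.+ - a) ℤ.+ - - a ≡ b
  identity = solve-∀

-- The transfer matrix

bit : Bool → ℕ
bit true  = 1
bit false = 0

sign : Bool → ℤ
sign true  = ℤ.1ℤ
sign false = ℤ.-1ℤ

transfer : Bool → Bool → UPoly
transfer a b = scale (sign b) (falling (bit b ℕ.+ bit (not a)))

scalarMatrix : UPoly → Bool → Bool → UPoly
scalarMatrix p true  true  = p
scalarMatrix p true  false = []
scalarMatrix p false true  = []
scalarMatrix p false false = p

transferPow : ℕ → Bool → Bool → UPoly
transferPow zero          = scalarMatrix (ℤ.1ℤ ∷ [])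
transferPow (suc n) a c   = transfer a true ⊛ transferPow n true c ⊕ transfer a false ⊛ transferPow n false c

transferAction : Bool → Bool → UPoly → UPoly
transferAction true  true  q = x· q
transferAction true  false q = -ₚ q
transferAction false true  q = -ₚ x· q ⊕ x· x· q
transferAction false false q = -ₚ x· q

transfer-⊛ : ∀ a b q → transfer a b ⊛ q ≋ transferAction a b q
transfer-⊛ true  true  q = ≋-trans (x·-⊛ (ℤ.1ℤ ∷ []) q) (x·-cong (≋-trans (const-⊛ ℤ.1ℤ q) (scale-1 q)))
transfer-⊛ true  false q = const-⊛ ℤ.-1ℤ q
transfer-⊛ false true  q = ≋-trans (x·-⊛ (ℤ.-1ℤ ∷ ℤ.1ℤ ∷ []) q)
  (x·-cong (⊕-cong (≋-refl { -ₚ q}) (x·-cong (≋-trans (const-⊛ ℤ.1ℤ q) (scale-1 q)))))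
transfer-⊛ false false q = ≋-trans (x·-⊛ (ℤ.-1ℤ ∷ []) q) (x·-cong (const-⊛ ℤ.-1ℤ q))

-- x· commutes with -ₚ_ and _⊕_ definitionally, so the four entries are instances of two identities.
transferAction² : ∀ a c q →
  transferAction a true (transferAction true c q) ⊕ transferAction a false (transferAction false c q)
    ≋ scalarMatrix (x· q) a c
transferAction² true  true  q = p⊕neg[negq⊕p]≋q (x· x· q) (x· q)
transferAction² true  false q = ⊕-inverseʳ (-ₚ x· q)
transferAction² false true  q = ⊕-inverseʳ (-ₚ x· x· q ⊕ x· x· x· q)
transferAction² false false q = neg²q⊕negp⊕neg²p≋q (x· x· q) (x· q)

transfer² : ∀ a c q →
  transfer a true ⊛ (transfer true c ⊛ q) ⊕ transfer a false ⊛ (transfer false c ⊛ q) ≋ scalarMatrix (x· q) a c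
transfer² a c q = ≋-trans (⊕-cong (twoSteps true) (twoSteps false)) (transferAction² a c q)
  where
  twoSteps : ∀ b → transfer a b ⊛ (transfer b c ⊛ q) ≋ transferAction a b (transferAction b c q)
  twoSteps b = ≋-trans (⊛-congʳ (transfer a b) (transfer-⊛ b c q)) (transfer-⊛ a b _)

⊛-scalarMatrix : ∀ r p a c → r ⊛ scalarMatrix p a c ≋ scalarMatrix (r ⊛ p) a c
⊛-scalarMatrix r p true  true  = ≋-refl
⊛-scalarMatrix r p true  false = ⊛-zeroʳ r
⊛-scalarMatrix r p false true  = ⊛-zeroʳ r
⊛-scalarMatrix r p false false = ≋-refl

scalarMatrix-columnSum : ∀ (f : Bool → UPoly) c →
  scalarMatrix (f true) true c ⊕ scalarMatrix (f false) false c ≋ f c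
scalarMatrix-columnSum f true  = ⊕-identityʳ (f true)
scalarMatrix-columnSum f false = ≋-refl

scalarMatrix-rowSum : ∀ (f : Bool → UPoly) a →
  scalarMatrix (f true) a true ⊕ scalarMatrix (f false) a false ≋ f a
scalarMatrix-rowSum f true  = ⊕-identityʳ (f true)
scalarMatrix-rowSum f false = ≋-refl

transferPow-suc-scalar : ∀ n p → (∀ a c → transferPow n a c ≋ scalarMatrix p a c) →
  ∀ a c → transferPow (suc n) a c ≋ transfer a c ⊛ p
transferPow-suc-scalar n p Tⁿ≋pI a c = begin
  transfer a true ⊛ transferPow n true c ⊕ transfer a false ⊛ transferPow n false c
    ≈⟨ ⊕-cong (⊛-congʳ (transfer a true) (Tⁿ≋pI true c)) (⊛-congʳ (transfer a false) (Tⁿ≋pI false c)) ⟩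
  transfer a true ⊛ scalarMatrix p true c ⊕ transfer a false ⊛ scalarMatrix p false c
    ≈⟨ ⊕-cong (⊛-scalarMatrix (transfer a true) p true c) (⊛-scalarMatrix (transfer a false) p false c) ⟩
  scalarMatrix (transfer a true ⊛ p) true c ⊕ scalarMatrix (transfer a false ⊛ p) false c
    ≈⟨ scalarMatrix-columnSum (λ b → transfer a b ⊛ p) c ⟩
  transfer a c ⊛ p ∎
  where open ≋-Reasoning

transferPow-even : ∀ j a c → transferPow (2 * j) a c ≋ scalarMatrix (xPow j) a c
transferPow-even zero    a c = ≋-refl
transferPow-even (suc j) a c = begin
  transferPow (2 * suc j) a c
    ≡⟨ cong (λ n → transferPow n a c) (ℕ.*-suc 2 j) ⟩
  transfer a true ⊛ transferPow (suc (2 * j)) true c ⊕ transfer a false ⊛ transferPow (suc (2 * j)) false c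
    ≈⟨ ⊕-cong (⊛-congʳ (transfer a true) (odd true c)) (⊛-congʳ (transfer a false) (odd false c)) ⟩
  transfer a true ⊛ (transfer true c ⊛ xPow j) ⊕ transfer a false ⊛ (transfer false c ⊛ xPow j)
    ≈⟨ transfer² a c (xPow j) ⟩
  scalarMatrix (xPow (suc j)) a c ∎
  where
  open ≋-Reasoning
  odd : ∀ b c → transferPow (suc (2 * j)) b c ≋ transfer b c ⊛ xPow j
  odd = transferPow-suc-scalar (2 * j) (xPow j) (transferPow-even j)

lastOr : ∀ {n} → Bool → Vec Bool n → Bool
lastOr a []      = a
lastOr a (b ∷ v) = lastOr b v

walk : ∀ {n} → Bool → Vec Bool n → UPoly
walk a []      = ℤ.1ℤ ∷ []
walk a (b ∷ v) = transfer a b ⊛ walk b v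

choices : (n : ℕ) → List (Vec Bool n)
choices zero    = [] ∷ []
choices (suc n) = map (true ∷_) (choices n) ++ map (false ∷_) (choices n)

∑-walk : ∀ n a c → ∑ (λ v → scalarMatrix (walk a v) (lastOr a v) c) (choices n) ≋ transferPow n a c
∑-walk zero    a c = ⊕-identityʳ _
∑-walk (suc n) a c = begin
  ∑ entry (map (true ∷_) (choices n) ++ map (false ∷_) (choices n))
    ≈⟨ ∑-++ entry (map (true ∷_) (choices n)) _ ⟩
  ∑ entry (map (true ∷_) (choices n)) ⊕ ∑ entry (map (false ∷_) (choices n))
    ≡⟨ cong₂ _⊕_ (∑-map entry (true ∷_) (choices n)) (∑-map entry (false ∷_) (choices n)) ⟩
  ∑ (λ v → entry (true ∷ v)) (choices n) ⊕ ∑ (λ v → entry (false ∷ v)) (choices n)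
    ≈⟨ ⊕-cong (firstStep true) (firstStep false) ⟩
  transfer a true ⊛ transferPow n true c ⊕ transfer a false ⊛ transferPow n false c ∎
  where
  open ≋-Reasoning
  entry : Vec Bool (suc n) → UPoly
  entry v = scalarMatrix (walk a v) (lastOr a v) c
  firstStep : ∀ b → ∑ (λ v → entry (b ∷ v)) (choices n) ≋ transfer a b ⊛ transferPow n b c
  firstStep b = begin
    ∑ (λ v → scalarMatrix (transfer a b ⊛ walk b v) (lastOr b v) c) (choices n)
      ≈⟨ ∑-cong (choices n) (λ v → ⊛-scalarMatrix (transfer a b) (walk b v) (lastOr b v) c) ⟨
    ∑ (λ v → transfer a b ⊛ scalarMatrix (walk b v) (lastOr b v) c) (choices n)
      ≈⟨ ⊛-∑ (transfer a b) _ (choices n) ⟨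
    transfer a b ⊛ ∑ (λ v → scalarMatrix (walk b v) (lastOr b v) c) (choices n)
      ≈⟨ ⊛-congʳ (transfer a b) (∑-walk n b c) ⟩
    transfer a b ⊛ transferPow n b c ∎

-- Cyclic indices and the Kronecker delta

prev : ∀ {m} → Fin (suc m) → Fin (suc m)
prev {m} zero = fromℕ m
prev (suc j)  = inject₁ j

toℕ-next : ∀ {m} (i : Fin (suc m)) → toℕ (next i) ≡ suc (toℕ i) % suc m
toℕ-next i = Fin.toℕ-fromℕ< _

next-fromℕ : ∀ m → next (fromℕ m) ≡ zero
next-fromℕ m = Fin.toℕ-injective (begin
  toℕ (next (fromℕ m))       ≡⟨ toℕ-next (fromℕ m) ⟩
  suc (toℕ (fromℕ m)) % suc m ≡⟨ cong (λ k → suc k % suc m) (Fin.toℕ-fromℕ m) ⟩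
  suc m % suc m              ≡⟨ n%n≡0 (suc m) ⟩
  0                          ∎)
  where open ≡-Reasoning

next-inject₁ : ∀ {m} (i : Fin m) → next (inject₁ i) ≡ suc i
next-inject₁ {m} i = Fin.toℕ-injective (begin
  toℕ (next (inject₁ i))        ≡⟨ toℕ-next (inject₁ i) ⟩
  suc (toℕ (inject₁ i)) % suc m ≡⟨ cong (λ k → suc k % suc m) (Fin.toℕ-inject₁ i) ⟩
  suc (toℕ i) % suc m           ≡⟨ m<n⇒m%n≡m (s≤s (Fin.toℕ<n i)) ⟩
  suc (toℕ i)                   ∎)
  where open ≡-Reasoning

next-prev : ∀ {m} (j : Fin (suc m)) → next (prev j) ≡ j
next-prev {m} zero = next-fromℕ m
next-prev (suc j)  = next-inject₁ j

fromℕ-or-inject₁ : ∀ {m} (i : Fin (suc m)) → i ≡ fromℕ m ⊎ Σ (Fin m) (λ i′ → i ≡ inject₁ i′)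
fromℕ-or-inject₁ {zero}  zero    = inj₁ refl
fromℕ-or-inject₁ {suc m} zero    = inj₂ (zero , refl)
fromℕ-or-inject₁ {suc m} (suc i) with fromℕ-or-inject₁ i
... | inj₁ i≡fromℕ       = inj₁ (cong suc i≡fromℕ)
... | inj₂ (i′ , i≡i′)   = inj₂ (suc i′ , cong suc i≡i′)

prev-next : ∀ {m} (i : Fin (suc m)) → prev (next i) ≡ i
prev-next {m} i with fromℕ-or-inject₁ i
... | inj₁ refl       = cong prev (next-fromℕ m)
... | inj₂ (i′ , refl) = cong prev (next-inject₁ i′)

-- `var i` is built from a Kronecker delta local to its `where` block; this names it.
var-exponent : ∀ {n} (i : Fin n) → Σ (Fin n → ℕ) λ e → var i ≡ (ℤ.1ℤ , Vec.tabulate e) ∷ []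
var-exponent i = _ , refl

δ : ∀ {n} → Fin n → Fin n → ℕ
δ i = proj₁ (var-exponent i)

δ-≡ : ∀ {n} {i j : Fin n} → i ≡ j → δ i j ≡ 1
δ-≡ {i = i} {j} i≡j with i Fin.≟ j
... | yes _  = refl
... | no i≢j = ⊥-elim (i≢j i≡j)

δ-≢ : ∀ {n} {i j : Fin n} → ¬ i ≡ j → δ i j ≡ 0
δ-≢ {i = i} {j} i≢j with i Fin.≟ j
... | yes i≡j = ⊥-elim (i≢j i≡j)
... | no _    = refl

δ-respects-⇔ : ∀ {m n} {i j : Fin m} {i′ j′ : Fin n} → (i ≡ j → i′ ≡ j′) → (i′ ≡ j′ → i ≡ j) → δ i j ≡ δ i′ j′
δ-respects-⇔ {i = i} {j} {i′} {j′} to from = by-cases (i Fin.≟ j)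
  where
  by-cases : Dec (i ≡ j) → δ i j ≡ δ i′ j′
  by-cases (yes i≡j) = trans (δ-≡ i≡j) (sym (δ-≡ (to i≡j)))
  by-cases (no i≢j)  = trans (δ-≢ i≢j) (sym (δ-≢ (i≢j ∘ from)))

δ-next : ∀ {m} (i j : Fin (suc m)) → δ (next i) j ≡ δ i (prev j)
δ-next i j = δ-respects-⇔ (λ next-i≡j → trans (sym (prev-next i)) (cong prev next-i≡j))
                          (λ i≡prev-j → trans (cong next i≡prev-j) (next-prev j))

sum-δ : ∀ {n} (w : Fin n → ℕ) j → sum (λ i → w i ℕ.* δ i j) ≡ w j
sum-δ {suc n} w zero = begin
  w zero ℕ.* 1 ℕ.+ sum {n} (λ i → w (suc i) ℕ.* 0)
    ≡⟨ cong₂ ℕ._+_ (ℕ.*-identityʳ (w zero)) (sum-cong-≗ (λ i → ℕ.*-zeroʳ (w (suc i)))) ⟩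
  w zero ℕ.+ sum {n} (λ _ → 0)
    ≡⟨ cong (w zero ℕ.+_) (sum-replicate-zero n) ⟩
  w zero ℕ.+ 0
    ≡⟨ ℕ.+-identityʳ (w zero) ⟩
  w zero ∎
  where open ≡-Reasoning
sum-δ {suc n} w (suc j) = begin
  w zero ℕ.* 0 ℕ.+ sum {n} (λ i → w (suc i) ℕ.* δ (suc i) (suc j))
    ≡⟨ cong₂ ℕ._+_ (ℕ.*-zeroʳ (w zero))
                   (sum-cong-≗ (λ i → cong (w (suc i) ℕ.*_) (δ-respects-⇔ Fin.suc-injective (cong suc)))) ⟩
  sum (λ i → w (suc i) ℕ.* δ i j)
    ≡⟨ sum-δ (w ∘ suc) j ⟩
  w (suc j) ∎
  where open ≡-Reasoning

-- Expanding P_n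

pick : ∀ {m} → Fin (suc m) → Bool → Fin (suc m)
pick i true  = i
pick i false = next i

choiceSign : ∀ {n} → Vec Bool n → ℤ
choiceSign []      = ℤ.1ℤ
choiceSign (b ∷ s) = sign b ℤ.* choiceSign s

exponentOf : ∀ {n m} → (Fin n → Fin (suc m)) → Vec Bool n → Vec ℕ (suc m)
exponentOf h []      = Vec.replicate _ 0
exponentOf h (b ∷ s) = Vec.zipWith ℕ._+_ (Vec.tabulate (δ (pick (h zero) b))) (exponentOf (h ∘ suc) s)

term : ∀ {n m} → (Fin n → Fin (suc m)) → Vec Bool n → ℤ × Monomial (suc m)
term h s = choiceSign s , exponentOf h s

factor : ∀ {m} → Fin (suc m) → MPoly (suc m)
factor i = msub (var i) (var (next i))

expand-∏ : ∀ {n m} (h : Fin n → Fin (suc m)) →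
  foldr mmul mone (map factor (List.tabulate h)) ≡ map (term h) (choices n)
expand-∏ {zero}  h = refl
expand-∏ {suc n} h = begin
  mmul (factor (h zero)) (foldr mmul mone (map factor (List.tabulate (h ∘ suc))))
    ≡⟨ cong (mmul (factor (h zero))) (expand-∏ (h ∘ suc)) ⟩
  mmul (factor (h zero)) (map (term (h ∘ suc)) (choices n))
    ≡⟨ cong₂ _++_ (trans (sym (map-∘ (choices n))) (map-∘ (choices n)))
                  (trans (++-identityʳ _) (trans (sym (map-∘ (choices n))) (map-∘ (choices n)))) ⟩
  map (term h) (map (true ∷_) (choices n)) ++ map (term h) (map (false ∷_) (choices n))
    ≡⟨ map-++ (term h) (map (true ∷_) (choices n)) _ ⟨
  map (term h) (choices (suc n)) ∎
  where open ≡-Reasoning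

𝓛-map-term : ∀ {n m} (h : Fin n → Fin (suc m)) xs →
  𝓛 (map (term h) xs) ≡ ∑ (λ s → scale (choiceSign s) (𝓛mon (exponentOf h s))) xs
𝓛-map-term h []       = refl
𝓛-map-term h (s ∷ xs) = cong (scale (choiceSign s) (𝓛mon (exponentOf h s)) ⊕_) (𝓛-map-term h xs)

lookup-exponentOf : ∀ {n m} (h : Fin n → Fin (suc m)) s j →
  Vec.lookup (exponentOf h s) j ≡ sum (λ i → δ (pick (h i) (Vec.lookup s i)) j)
lookup-exponentOf h []      j = lookup-replicate j 0
lookup-exponentOf h (b ∷ s) j = trans (lookup-zipWith ℕ._+_ j (Vec.tabulate (δ (pick (h zero) b))) (exponentOf (h ∘ suc) s))
  (cong₂ ℕ._+_ (lookup∘tabulate (δ (pick (h zero) b)) j) (lookup-exponentOf (h ∘ suc) s j))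

δ-pick : ∀ {m} (i j : Fin (suc m)) b → δ (pick i b) j ≡ bit b ℕ.* δ i j ℕ.+ bit (not b) ℕ.* δ (next i) j
δ-pick i j true  = sym (trans (ℕ.+-identityʳ _) (ℕ.*-identityˡ _))
δ-pick i j false = sym (ℕ.*-identityˡ _)

exponents : ∀ {n} → Bool → Vec Bool n → Vec ℕ n
exponents a []      = []
exponents a (b ∷ v) = bit b ℕ.+ bit (not a) ∷ exponents b v

lookup-exponents : ∀ {n} a (v : Vec Bool n) j →
  Vec.lookup (exponents a v) j ≡ bit (Vec.lookup v j) ℕ.+ bit (not (Vec.lookup (a ∷ v) (inject₁ j)))
lookup-exponents a (b ∷ v) zero    = refl
lookup-exponents a (b ∷ v) (suc j) = lookup-exponents b v j

lookup-fromℕ : ∀ {m} b (v : Vec Bool m) → Vec.lookup (b ∷ v) (fromℕ m) ≡ lastOr b v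
lookup-fromℕ b []      = refl
lookup-fromℕ b (c ∷ v) = lookup-fromℕ c v

lookup-prev : ∀ {m} b (v : Vec Bool m) j →
  Vec.lookup (lastOr b v ∷ b ∷ v) (inject₁ j) ≡ Vec.lookup (b ∷ v) (prev j)
lookup-prev b v zero    = sym (lookup-fromℕ b v)
lookup-prev b v (suc j) = refl

exponentOf-cyclic : ∀ {m} b (v : Vec Bool m) → exponentOf id (b ∷ v) ≡ exponents (lastOr b v) (b ∷ v)
exponentOf-cyclic b v = begin
  exponentOf id s                               ≡⟨ tabulate∘lookup _ ⟨
  Vec.tabulate (Vec.lookup (exponentOf id s))   ≡⟨ tabulate-cong lookup-≗ ⟩
  Vec.tabulate (Vec.lookup (exponents _ s))     ≡⟨ tabulate∘lookup _ ⟩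
  exponents (lastOr b v) s                      ∎
  where
  open ≡-Reasoning
  s = b ∷ v
  chosen : Fin _ → ℕ
  chosen i = bit (Vec.lookup s i)
  skipped : Fin _ → ℕ
  skipped i = bit (not (Vec.lookup s i))
  lookup-≗ : ∀ j → Vec.lookup (exponentOf id s) j ≡ Vec.lookup (exponents (lastOr b v) s) j
  lookup-≗ j = begin
    Vec.lookup (exponentOf id s) j
      ≡⟨ lookup-exponentOf id s j ⟩
    sum (λ i → δ (pick i (Vec.lookup s i)) j)
      ≡⟨ sum-cong-≗ (λ i → δ-pick i j (Vec.lookup s i)) ⟩
    sum (λ i → chosen i ℕ.* δ i j ℕ.+ skipped i ℕ.* δ (next i) j)
      ≡⟨ ∑-distrib-+ (λ i → chosen i ℕ.* δ i j) (λ i → skipped i ℕ.* δ (next i) j) ⟩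
    sum (λ i → chosen i ℕ.* δ i j) ℕ.+ sum (λ i → skipped i ℕ.* δ (next i) j)
      ≡⟨ cong₂ ℕ._+_ (sum-δ chosen j)
                     (trans (sum-cong-≗ (λ i → cong (skipped i ℕ.*_) (δ-next i j))) (sum-δ skipped (prev j))) ⟩
    chosen j ℕ.+ skipped (prev j)
      ≡⟨ trans (lookup-exponents (lastOr b v) s j) (cong (λ a → chosen j ℕ.+ bit (not a)) (lookup-prev b v j)) ⟨
    Vec.lookup (exponents (lastOr b v) s) j ∎

signed-𝓛mon-exponents : ∀ {n} a (s : Vec Bool n) → scale (choiceSign s) (𝓛mon (exponents a s)) ≋ walk a s
signed-𝓛mon-exponents a []      = ≋-refl
signed-𝓛mon-exponents a (b ∷ s) = begin
  scale (sign b ℤ.* choiceSign s) (falling (bit b ℕ.+ bit (not a)) ⊛ 𝓛mon (exponents b s))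
    ≈⟨ scale-⊛-scale (sign b) (choiceSign s) (falling (bit b ℕ.+ bit (not a))) (𝓛mon (exponents b s)) ⟨
  transfer a b ⊛ scale (choiceSign s) (𝓛mon (exponents b s))
    ≈⟨ ⊛-congʳ (transfer a b) (signed-𝓛mon-exponents b s) ⟩
  transfer a b ⊛ walk b s ∎
  where open ≋-Reasoning

trace : ℕ → UPoly
trace n = transferPow n true true ⊕ transferPow n false false

𝓛-Pcyc : ∀ n .{{_ : ℕ.NonZero n}} → 𝓛 (Pcyc n) ≋ trace n
𝓛-Pcyc (suc m) = begin
  𝓛 (Pcyc (suc m))
    ≡⟨ cong 𝓛 (expand-∏ {suc m} {m} id) ⟩
  𝓛 (map (term id) (choices (suc m)))
    ≡⟨ 𝓛-map-term {suc m} {m} id (choices (suc m)) ⟩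
  ∑ (λ s → scale (choiceSign s) (𝓛mon (exponentOf id s))) (choices (suc m))
    ≈⟨ ∑-cong (choices (suc m)) closedWalk ⟩
  ∑ (λ s → diagonalWalk true s ⊕ diagonalWalk false s) (choices (suc m))
    ≈⟨ ∑-⊕ (diagonalWalk true) (diagonalWalk false) (choices (suc m)) ⟩
  ∑ (diagonalWalk true) (choices (suc m)) ⊕ ∑ (diagonalWalk false) (choices (suc m))
    ≈⟨ ⊕-cong (∑-walk (suc m) true true) (∑-walk (suc m) false false) ⟩
  trace (suc m) ∎
  where
  open ≋-Reasoning
  diagonalWalk : Bool → Vec Bool (suc m) → UPoly
  diagonalWalk a s = scalarMatrix (walk a s) (lastOr a s) a
  closedWalk : ∀ s → scale (choiceSign s) (𝓛mon (exponentOf id s)) ≋ diagonalWalk true s ⊕ diagonalWalk false s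
  closedWalk (b ∷ v) = begin
    scale (choiceSign (b ∷ v)) (𝓛mon (exponentOf id (b ∷ v)))
      ≡⟨ cong (scale (choiceSign (b ∷ v)) ∘ 𝓛mon) (exponentOf-cyclic b v) ⟩
    scale (choiceSign (b ∷ v)) (𝓛mon (exponents (lastOr b v) (b ∷ v)))
      ≈⟨ signed-𝓛mon-exponents (lastOr b v) (b ∷ v) ⟩
    walk (lastOr b v) (b ∷ v)
      ≈⟨ scalarMatrix-rowSum (λ a → walk a (b ∷ v)) (lastOr b v) ⟨
    diagonalWalk true (b ∷ v) ⊕ diagonalWalk false (b ∷ v) ∎

lemma3p2 : (k : ℕ) → 1 ≤ k →
    𝓛 (Pcyc (2 * k)) ≈ₚ scale (+ 2) (xPow k)
lemma3p2 (suc k) _ = ≋⇒≈ₚ (begin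
  𝓛 (Pcyc (2 * suc k))          ≈⟨ 𝓛-Pcyc (2 * suc k) ⟩
  trace (2 * suc k)             ≈⟨ ⊕-cong (transferPow-even (suc k) true true) (transferPow-even (suc k) false false) ⟩
  xPow (suc k) ⊕ xPow (suc k)   ≈⟨ ⊕-double (xPow (suc k)) ⟩
  scale (+ 2) (xPow (suc k))    ∎)
  where open ≋-Reasoning
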